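{- Let $n\ge 1$, $A\subseteq\{1,\dots,n\}$ nonempty, $a=\min(A)$, and let $\mathbf p$ be a reduced position of $SN(n,A)$ with $p_n=\max_i p_i$. Suppose a legal move on $\ell\in A$ stacks takes $\mathbf p$ to a position $\mathbf p'$ that is not reduced. Then one of the following holds: (R1) $\ell>a$, all stacks of maximal height $p_n$ are played on, and $\Sigma(\mathbf p)=a\cdot p_n+r$ with $0\le r<\ell-a$; (R2) at least one stack of maximal height $p_n$ is not played on, and $\Sigma(\mathbf p)=a\cdot p_n+r$ with $0\le r<\ell$.
   Context: The game $SN(n,A)$ is played on $n$ stacks of tokens; a position is $\mathbf p=(p_1,\dots,p_n)$ of nonnegative integers, in non-decreasing order. A move consists of choosing some $\ell\in A$ and $\ell$ distinct stacks, each of height at least $1$, and removing exactly one token from each. $\Sigma(\mathbf p)=\sum_i p_i$. A terminal position is one with no legal move. For a position $\mathbf p$, let $\mathcal T(\mathbf p)$ be the set of terminal positions reachable from $\mathbf p$ by finite sequences of legal moves, $u_i(\mathbf p)=\min\{t_i:\mathbf t\in\mathcal T(\mathbf p)\}$, $r(\mathbf p)=\mathbf p-u(\mathbf p)$; $\mathbf p$ is reduced if $r(\mathbf p)=\mathbf p$. -}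

module Defs where

open import Data.Nat using (ℕ; zero; suc; _+_; _∸_; _≤_)
open import Data.Fin using (Fin)
open import Data.Fin.Subset using (Subset; _∈_; ∣_∣)
open import Data.Vec using (lookup)
open import Data.Bool using (if_then_else_)
open import Data.List using (List)
open import Data.List.Membership.Propositional using () renaming (_∈_ to _∈ₗ_)
open import Data.Product using (Σ; ∃; _×_)
open import Relation.Nullary using (¬_)
open import Relation.Binary.PropositionalEquality using (_≡_)
open import Relation.Binary.Construct.Closure.ReflexiveTransitive using (Star)
import Data.Vec.Functional as VF

-- A position of SN(n,A) on n stacks: heights indexed by Fin n
-- (unsorted representation).
Position : ℕ → Set
Position n = Fin n → ℕ

Σp : ∀ {n} → Position n → ℕ
Σp p = VF.foldr _+_ 0 p

apply : ∀ {n} → Position n → Subset n → Position n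
apply p S i = if lookup S i then p i ∸ 1 else p i

LegalMove : ∀ {n} → List ℕ → Position n → ℕ → Subset n → Set
LegalMove A p ℓ S = (ℓ ∈ₗ A) × (∣ S ∣ ≡ ℓ) × (∀ i → i ∈ S → 1 ≤ p i)

Move : ∀ {n} → List ℕ → Position n → Position n → Set
Move A p q = Σ ℕ λ ℓ → Σ (Subset _) λ S → LegalMove A p ℓ S × (∀ i → q i ≡ apply p S i)

Reach : ∀ {n} → List ℕ → Position n → Position n → Set
Reach A = Star (Move A)

Terminal : ∀ {n} → List ℕ → Position n → Set
Terminal A t = ¬ (∃ λ q → Move A t q)

IsU : ∀ {n} → List ℕ → Position n → Fin n → ℕ → Set
IsU A p i m =
  (∃ λ t → Reach A p t × Terminal A t × t i ≡ m) ×
  (∀ t → Reach A p t → Terminal A t → m ≤ t i)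

-- p reduced: r(p) = p - u(p) = p componentwise
Reduced : ∀ {n} → List ℕ → Position n → Set
Reduced A p = ∀ i m → IsU A p i m → p i ∸ m ≡ p i

{-# OPTIONS --safe #-}
-- If every stack of q has height at most M and a·M ≤ Σ(q), then q is reduced: for c = q_i,
-- the invariant a·c ≤ Σ_j min(q_j, c) allows a move on a stacks that contains stack i and
-- keeps the invariant for c − 1 (take a stacks of height ≥ c if there are that many, and
-- otherwise all of them together with further nonempty stacks), so stack i can be emptied.
-- Conversely, a move lowers Σ by ℓ ≥ a and every stack by at most one, so a reachable
-- terminal position t gives a·(p_i − t_i) ≤ Σ(p); taking t_i = u_i(p), reducedness of p
-- yields a·p_i ≤ Σ(p).
-- After the move, p' is bounded by p_n, and by p_n − 1 if every maximal stack was played.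
-- As p' is not reduced, Σ(p) − ℓ = Σ(p') < a·p_n, resp. a·(p_n − 1), and together with
-- a·p_n ≤ Σ(p) this gives the bound on Σ(p) in (R2), resp. (R1).
module Submission where

open import Defs
open import Data.Nat
  using (ℕ; zero; suc; _+_; _*_; _∸_; _⊓_; _≤_; _<_; z≤n; s≤s; _≤?_; _≟_)
open import Data.Nat.Properties
open import Data.Nat.Induction using (<-rec; <-wellFounded)
open import Algebra.Properties.Semiring.Sum +-*-semiring using (sum-cong-≗; *-distribˡ-sum)
open import Data.Fin using (zero; suc; fromℕ) renaming (_≤_ to _≤ᶠ_)
open import Data.Fin.Properties using (any?)
open import Data.Fin.Subset using (Subset; inside; outside; _∈_; _∉_; _⊆_; ∣_∣; ⁅_⁆)
open import Data.Fin.Subset.Properties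
  using (_∈?_; drop-there; drop-∷-⊆; out⊆; s⊆s; p⊆q⇒∣p∣≤∣q∣; x∈⁅x⁆; x∈⁅y⁆⇒x≡y; ∣⁅x⁆∣≡1)
open import Data.Vec using ([]; _∷_; here; there; lookup; tabulate)
open import Data.Vec.Properties using ([]=⇒lookup; lookup⇒[]=; lookup∘tabulate)
open import Data.Bool using (true; false)
open import Data.List using (List)
open import Data.List.Relation.Unary.All as All using (All)
open import Data.List.Membership.Propositional using () renaming (_∈_ to _∈ₗ_)
open import Data.Product using (Σ; ∃; _×_; _,_; proj₁)
open import Data.Sum using (_⊎_; inj₁; inj₂)
open import Effect.Monad using (RawMonad)
open import Function using (_∘_; _on_; case_of_)
open import Induction.WellFounded using (Acc; acc)
import Relation.Binary.Construct.On as On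
open import Relation.Binary.Construct.Closure.ReflexiveTransitive using (ε; _◅_; _◅◅_)
open import Relation.Binary.PropositionalEquality
open import Relation.Nullary using (¬_; yes; no; does; contradiction)
open import Relation.Nullary.Decidable using (decidable-stable; dec-true; dec-false; ¬¬-excluded-middle; _×-dec_; ¬?)
open import Relation.Nullary.Negation using (¬¬-Monad)

Σp-mono : ∀ {n} {f g : Position n} → (∀ i → f i ≤ g i) → Σp f ≤ Σp g
Σp-mono {zero}  f≤g = z≤n
Σp-mono {suc n} f≤g = +-mono-≤ (f≤g zero) (Σp-mono (f≤g ∘ suc))

c*∣S∣≤Σp : ∀ {n c} (S : Subset n) {f : Position n} → (∀ i → i ∈ S → c ≤ f i) → c * ∣ S ∣ ≤ Σp f
c*∣S∣≤Σp {c = c} [] _ = ≤-reflexive (*-zeroʳ c)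
c*∣S∣≤Σp {c = c} (inside ∷ S) {f} c≤f = begin
  c * suc ∣ S ∣          ≡⟨ *-suc c ∣ S ∣ ⟩
  c + c * ∣ S ∣          ≤⟨ +-mono-≤ (c≤f zero here) (c*∣S∣≤Σp S (λ i → c≤f (suc i) ∘ there)) ⟩
  f zero + Σp (f ∘ suc)  ∎
  where open ≤-Reasoning
c*∣S∣≤Σp (outside ∷ S) {f} c≤f =
  ≤-trans (c*∣S∣≤Σp S (λ i → c≤f (suc i) ∘ there)) (m≤n+m _ (f zero))

Σp≤c*∣S∣ : ∀ {n c} (S : Subset n) {f : Position n} →
           (∀ i → f i ≤ c) → (∀ i → i ∉ S → f i ≡ 0) → Σp f ≤ c * ∣ S ∣
Σp≤c*∣S∣ [] _ _ = z≤n
Σp≤c*∣S∣ {c = c} (inside ∷ S) {f} f≤c f≡0 = begin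
  f zero + Σp (f ∘ suc)  ≤⟨ +-mono-≤ (f≤c zero) (Σp≤c*∣S∣ S (f≤c ∘ suc) (λ i i∉S → f≡0 (suc i) (i∉S ∘ drop-there))) ⟩
  c + c * ∣ S ∣          ≡⟨ sym (*-suc c ∣ S ∣) ⟩
  c * suc ∣ S ∣          ∎
  where open ≤-Reasoning
Σp≤c*∣S∣ {c = c} (outside ∷ S) {f} f≤c f≡0 = begin
  f zero + Σp (f ∘ suc)  ≡⟨ cong (_+ Σp (f ∘ suc)) (f≡0 zero λ ()) ⟩
  Σp (f ∘ suc)           ≤⟨ Σp≤c*∣S∣ S (f≤c ∘ suc) (λ i i∉S → f≡0 (suc i) (i∉S ∘ drop-there)) ⟩
  c * ∣ S ∣              ∎
  where open ≤-Reasoning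

apply-≤ : ∀ {n} (p : Position n) S i → apply p S i ≤ p i
apply-≤ p S i with lookup S i
... | true  = m∸n≤m (p i) 1
... | false = ≤-refl

≤-suc-apply : ∀ {n} (p : Position n) S i → p i ≤ suc (apply p S i)
≤-suc-apply p S i with lookup S i
... | true  = m≤n+m∸n (p i) 1
... | false = n≤1+n (p i)

apply-∈ : ∀ {n} (p : Position n) {S i} → i ∈ S → apply p S i ≡ p i ∸ 1
apply-∈ p i∈S rewrite []=⇒lookup i∈S = refl

apply-∉ : ∀ {n} (p : Position n) {S i} → i ∉ S → apply p S i ≡ p i
apply-∉ p {S} {i} i∉S with lookup S i in eq
... | true  = contradiction (lookup⇒[]= i S eq) i∉S
... | false = refl

Σp-apply : ∀ {n} (p : Position n) S → (∀ i → i ∈ S → 1 ≤ p i) → Σp (apply p S) + ∣ S ∣ ≡ Σp p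
Σp-apply p [] _ = refl
Σp-apply p (inside ∷ S) nonempty = begin
  p zero ∸ 1 + Σp (apply (p ∘ suc) S) + suc ∣ S ∣    ≡⟨ +-suc _ ∣ S ∣ ⟩
  suc (p zero ∸ 1 + Σp (apply (p ∘ suc) S) + ∣ S ∣)  ≡⟨ cong suc (+-assoc (p zero ∸ 1) _ ∣ S ∣) ⟩
  suc (p zero ∸ 1) + (Σp (apply (p ∘ suc) S) + ∣ S ∣) ≡⟨ cong₂ _+_ (m+[n∸m]≡n (nonempty zero here))
                                                          (Σp-apply (p ∘ suc) S (λ i → nonempty (suc i) ∘ there)) ⟩
  p zero + Σp (p ∘ suc)                              ∎
  where open ≡-Reasoning
Σp-apply p (outside ∷ S) nonempty = begin
  p zero + Σp (apply (p ∘ suc) S) + ∣ S ∣    ≡⟨ +-assoc (p zero) _ ∣ S ∣ ⟩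
  p zero + (Σp (apply (p ∘ suc) S) + ∣ S ∣)  ≡⟨ cong (p zero +_) (Σp-apply (p ∘ suc) S (λ i → nonempty (suc i) ∘ there)) ⟩
  p zero + Σp (p ∘ suc)                      ∎
  where open ≡-Reasoning

Σp-legal : ∀ {n A} {p : Position n} {ℓ S} → LegalMove A p ℓ S → Σp (apply p S) + ℓ ≡ Σp p
Σp-legal {p = p} {S = S} (_ , refl , nonempty) = Σp-apply p S nonempty

atLeast : ∀ {n} → ℕ → Position n → Subset n
atLeast c q = tabulate (λ j → does (c ≤? q j))

∈-atLeast⁺ : ∀ {n c} (q : Position n) i → c ≤ q i → i ∈ atLeast c q
∈-atLeast⁺ {c = c} q i c≤qi =
  lookup⇒[]= i (atLeast c q) (trans (lookup∘tabulate _ i) (dec-true (c ≤? q i) c≤qi))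

∈-atLeast⁻ : ∀ {n c} (q : Position n) i → i ∈ atLeast c q → c ≤ q i
∈-atLeast⁻ {c = c} q i i∈ = decidable-stable (c ≤? q i) λ c≰qi →
  contradiction (trans (sym ([]=⇒lookup i∈)) (trans (lookup∘tabulate _ i) (dec-false (c ≤? q i) c≰qi))) λ ()

⊆-between : ∀ {n} {p q : Subset n} k → p ⊆ q → ∣ p ∣ ≤ k → k ≤ ∣ q ∣ →
            ∃ λ s → p ⊆ s × s ⊆ q × ∣ s ∣ ≡ k
⊆-between {p = []} {[]} zero _ _ _ = [] , (λ ()) , (λ ()) , refl
⊆-between {p = inside ∷ p} {outside ∷ q} k p⊆q _ _ = contradiction (p⊆q here) λ ()
⊆-between {p = inside ∷ p} {inside ∷ q} (suc k) p⊆q (s≤s ∣p∣≤k) (s≤s k≤∣q∣) =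
  let s , p⊆s , s⊆q , ∣s∣≡k = ⊆-between k (drop-∷-⊆ p⊆q) ∣p∣≤k k≤∣q∣
  in  inside ∷ s , s⊆s p⊆s , s⊆s s⊆q , cong suc ∣s∣≡k
⊆-between {p = outside ∷ p} {outside ∷ q} k p⊆q ∣p∣≤k k≤∣q∣ =
  let s , p⊆s , s⊆q , ∣s∣≡k = ⊆-between k (drop-∷-⊆ p⊆q) ∣p∣≤k k≤∣q∣
  in  outside ∷ s , s⊆s p⊆s , s⊆s s⊆q , ∣s∣≡k
⊆-between {p = outside ∷ p} {inside ∷ q} k p⊆q ∣p∣≤k k≤1+∣q∣ with k ≤? ∣ q ∣
... | yes k≤∣q∣ =
  let s , p⊆s , s⊆q , ∣s∣≡k = ⊆-between k (drop-∷-⊆ p⊆q) ∣p∣≤k k≤∣q∣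
  in  outside ∷ s , s⊆s p⊆s , out⊆ s⊆q , ∣s∣≡k
... | no k≰∣q∣ with k | k≤1+∣q∣
...   | zero  | _            = contradiction z≤n k≰∣q∣
...   | suc k′ | s≤s k′≤∣q∣ =
  let ∣p∣≤k′ = ≤-trans (p⊆q⇒∣p∣≤∣q∣ (drop-∷-⊆ p⊆q)) (≤-pred (≰⇒> k≰∣q∣))
      s , p⊆s , s⊆q , ∣s∣≡k′ = ⊆-between k′ (drop-∷-⊆ p⊆q) ∣p∣≤k′ k′≤∣q∣
  in  inside ∷ s , out⊆ p⊆s , s⊆s s⊆q , cong suc ∣s∣≡k′

¬¬-least : (P : ℕ → Set) {k : ℕ} → P k → ¬ ¬ ∃ λ m → P m × (∀ {m′} → P m′ → m ≤ m′)
¬¬-least P {k} = <-rec (λ k → P k → ¬ ¬ HasLeast) least-below k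
  where
  HasLeast : Set
  HasLeast = ∃ λ m → P m × (∀ {m′} → P m′ → m ≤ m′)
  least-below : ∀ k → (∀ {m} → m < k → P m → ¬ ¬ HasLeast) → P k → ¬ ¬ HasLeast
  least-below k below Pk no-least = ¬¬-excluded-middle {A = ∃ λ m → m < k × P m} λ where
    (yes (m , m<k , Pm)) → below m<k Pm no-least
    (no ∄smaller) → no-least (k , Pk , λ Pm′ → ≮⇒≥ λ m′<k → ∄smaller (_ , m′<k , Pm′))

cappedΣ : ∀ {n} → ℕ → Position n → ℕ
cappedΣ c q = Σp (λ j → q j ⊓ c)

c*x≤M*[x⊓c] : ∀ {x c M} → x ≤ M → c ≤ M → c * x ≤ M * (x ⊓ c)
c*x≤M*[x⊓c] {x} {c} {M} x≤M c≤M with ≤-total x c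
... | inj₁ x≤c rewrite m≤n⇒m⊓n≡m x≤c = *-monoˡ-≤ x c≤M
... | inj₂ c≤x rewrite m≥n⇒m⊓n≡n c≤x = ≤-trans (*-monoʳ-≤ c x≤M) (≤-reflexive (*-comm c M))

⊆atLeast⇒c*∣S∣≤cappedΣ : ∀ {n c} {q : Position n} {S} → S ⊆ atLeast (suc c) q →
                         c * ∣ S ∣ ≤ cappedΣ c (apply q S)
⊆atLeast⇒c*∣S∣≤cappedΣ {q = q} {S} S-tall = c*∣S∣≤Σp S λ j j∈S →
  ⊓-glb (≤-pred (≤-trans (∈-atLeast⁻ q j (S-tall j∈S)) (≤-suc-apply q S j))) ≤-refl

atLeast⊆⇒cappedΣ-apply : ∀ {n c} {q : Position n} {S} → atLeast (suc c) q ⊆ S → S ⊆ atLeast 1 q →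
                         cappedΣ c (apply q S) + ∣ S ∣ ≡ cappedΣ (suc c) q
atLeast⊆⇒cappedΣ-apply {c = c} {q} {S} tall⊆S S-nonempty = begin
  cappedΣ c (apply q S) + ∣ S ∣  ≡⟨ cong (_+ ∣ S ∣) (sum-cong-≗ capped-apply) ⟩
  Σp (apply capped S) + ∣ S ∣    ≡⟨ Σp-apply capped S (λ j j∈S → ⊓-glb (∈-atLeast⁻ q j (S-nonempty j∈S)) (s≤s z≤n)) ⟩
  cappedΣ (suc c) q              ∎
  where
  open ≡-Reasoning
  capped : Position _
  capped j = q j ⊓ suc c
  capped-apply : ∀ j → apply q S j ⊓ c ≡ apply capped S j
  capped-apply j with j ∈? S
  ... | yes j∈S = begin
    apply q S j ⊓ c          ≡⟨ cong (_⊓ c) (apply-∈ q j∈S) ⟩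
    (q j ∸ 1) ⊓ (suc c ∸ 1)  ≡⟨ sym (∸-distribʳ-⊓ 1 (q j) (suc c)) ⟩
    capped j ∸ 1             ≡⟨ sym (apply-∈ capped j∈S) ⟩
    apply capped S j         ∎
  ... | no j∉S = begin
    apply q S j ⊓ c   ≡⟨ cong (_⊓ c) (apply-∉ q j∉S) ⟩
    q j ⊓ c           ≡⟨ m≤n⇒m⊓n≡m qj≤c ⟩
    q j               ≡⟨ sym (m≤n⇒m⊓n≡m (m≤n⇒m≤1+n qj≤c)) ⟩
    capped j          ≡⟨ sym (apply-∉ capped j∉S) ⟩
    apply capped S j  ∎
    where
    qj≤c : q j ≤ c
    qj≤c = ≮⇒≥ (j∉S ∘ tall⊆S ∘ ∈-atLeast⁺ q j)

excess : ∀ {m n o} → m ≤ n → n < m + o → Σ ℕ λ r → n ≡ m + r × r < o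
excess {m} {n} {o} m≤n n<m+o = n ∸ m , sym (m+[n∸m]≡n m≤n) ,
  +-cancelˡ-< m (n ∸ m) o (subst (_< m + o) (sym (m+[n∸m]≡n m≤n)) n<m+o)

excess-shifted : ∀ {a P ℓ s} → ℓ ≤ s → a * P ≤ s → s < a * (P ∸ 1) + ℓ →
                 a < ℓ × Σ ℕ λ r → s ≡ a * P + r × r < ℓ ∸ a
excess-shifted {a} {zero} {ℓ} ℓ≤s _ s<a*0+ℓ =
  contradiction (subst (ℓ <_) (cong (_+ ℓ) (*-zeroʳ a)) (≤-<-trans ℓ≤s s<a*0+ℓ)) (<-irrefl refl)
excess-shifted {a} {suc P} {ℓ} {s} _ a*[1+P]≤s s<a*P+ℓ = ≤-<-trans (m≤m+n a r) a+r<ℓ , r , s≡a*[1+P]+r ,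
  m+n≤o⇒m≤o∸n (suc r) (subst (_≤ ℓ) (cong suc (+-comm a r)) a+r<ℓ)
  where
  open ≡-Reasoning
  r = s ∸ a * suc P
  s≡a*[1+P]+r : s ≡ a * suc P + r
  s≡a*[1+P]+r = sym (m+[n∸m]≡n a*[1+P]≤s)
  a+r<ℓ : a + r < ℓ
  a+r<ℓ = +-cancelˡ-< (a * P) (a + r) ℓ (subst (_< a * P + ℓ) (begin
    s                ≡⟨ s≡a*[1+P]+r ⟩
    a * suc P + r    ≡⟨ cong (_+ r) (trans (*-suc a P) (+-comm a (a * P))) ⟩
    a * P + a + r    ≡⟨ +-assoc (a * P) a r ⟩
    a * P + (a + r)  ∎) s<a*P+ℓ)

move-≤ : ∀ {n A} {p q : Position n} → Move A p q → ∀ i → q i ≤ p i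
move-≤ {p = p} (_ , S , _ , q≗) i = subst (_≤ p i) (sym (q≗ i)) (apply-≤ p S i)

reach-≤ : ∀ {n A} {p t : Position n} → Reach A p t → ∀ i → t i ≤ p i
reach-≤ ε         i = ≤-refl
reach-≤ (mv ◅ q↠t) i = ≤-trans (reach-≤ q↠t i) (move-≤ mv i)

Σp-move : ∀ {n A} {p q : Position n} (mv : Move A p q) → Σp q + proj₁ mv ≡ Σp p
Σp-move (ℓ , S , legal , q≗) = trans (cong (_+ ℓ) (sum-cong-≗ q≗)) (Σp-legal legal)

module Moves {A : List ℕ} (A-positive : ∀ {ℓ} → ℓ ∈ₗ A → 1 ≤ ℓ) where

  move-decreases : ∀ {n} {p q : Position n} → Move A p q → Σp q < Σp p
  move-decreases {q = q} mv@(_ , _ , (ℓ∈A , _) , _) =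
    subst (Σp q <_) (Σp-move mv) (m<m+n (Σp q) (A-positive ℓ∈A))

  -- Terminal positions (and, below, the minima u_i) exist here only under double negation;
  -- this suffices because every goal they serve is decidable.
  terminal-reachable : ∀ {n} (p : Position n) → ¬ ¬ ∃ λ t → Reach A p t × Terminal A t
  terminal-reachable p = go p (On.wellFounded Σp <-wellFounded p)
    where
    go : ∀ p → Acc (_<_ on Σp) p → ¬ ¬ ∃ λ t → Reach A p t × Terminal A t
    go p (acc smaller) no-terminal = ¬¬-excluded-middle λ where
      (no stuck)      → no-terminal (p , ε , stuck)
      (yes (q , p→q)) → go q (smaller (move-decreases p→q)) λ (t , q↠t , t-terminal) →
                          no-terminal (t , p→q ◅ q↠t , t-terminal)

  module Minimal {a : ℕ} (a∈A : a ∈ₗ A) (a-min : ∀ {ℓ} → ℓ ∈ₗ A → a ≤ ℓ) where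

    reach-invariant : ∀ {n} {p t : Position n} → Reach A p t → ∀ i → a * p i + Σp t ≤ Σp p + a * t i
    reach-invariant {p = p} ε i = ≤-reflexive (+-comm (a * p i) (Σp p))
    reach-invariant {p = p} {t} (_◅_ {j = q} mv@(ℓ , S , (ℓ∈A , _) , q≗) q↠t) i = begin
      a * p i + Σp t        ≤⟨ +-monoˡ-≤ (Σp t) (*-monoʳ-≤ a pi≤1+qi) ⟩
      a * suc (q i) + Σp t  ≡⟨ cong (_+ Σp t) (*-suc a (q i)) ⟩
      a + a * q i + Σp t    ≡⟨ +-assoc a _ _ ⟩
      a + (a * q i + Σp t)  ≤⟨ +-mono-≤ (a-min ℓ∈A) (reach-invariant q↠t i) ⟩
      ℓ + (Σp q + a * t i)  ≡⟨ sym (+-assoc ℓ _ _) ⟩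
      ℓ + Σp q + a * t i    ≡⟨ cong (_+ a * t i) (trans (+-comm ℓ (Σp q)) (Σp-move mv)) ⟩
      Σp p + a * t i        ∎
      where
      open ≤-Reasoning
      pi≤1+qi : p i ≤ suc (q i)
      pi≤1+qi = subst (λ x → p i ≤ suc x) (sym (q≗ i)) (≤-suc-apply p S i)

    reach-*∸≤Σp : ∀ {n} {p t : Position n} → Reach A p t → ∀ i → a * (p i ∸ t i) ≤ Σp p
    reach-*∸≤Σp {p = p} {t} p↠t i = begin
      a * (p i ∸ t i)             ≡⟨ *-distribˡ-∸ a (p i) (t i) ⟩
      a * p i ∸ a * t i           ≤⟨ ∸-monoˡ-≤ (a * t i) (m+n≤o⇒m≤o (a * p i) (reach-invariant p↠t i)) ⟩
      Σp p + a * t i ∸ a * t i    ≡⟨ m+n∸n≡m (Σp p) (a * t i) ⟩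
      Σp p                        ∎
      where open ≤-Reasoning

    reduced⇒*≤Σp : ∀ {n} {p : Position n} → Reduced A p → ∀ i → a * p i ≤ Σp p
    reduced⇒*≤Σp {p = p} reduced i = decidable-stable (a * p i ≤? Σp p) do
      t , p↠t , t-terminal ← terminal-reachable p
      m , (t′ , p↠t′ , t′-terminal , t′i≡m) , m-least ← ¬¬-least TerminalValue (t , p↠t , t-terminal , refl)
      let pi∸m≡pi = reduced i m ((t′ , p↠t′ , t′-terminal , t′i≡m) , λ t″ p↠t″ t″-terminal →
                                   m-least (t″ , p↠t″ , t″-terminal , refl))
      pure (subst (λ x → a * x ≤ Σp p) (trans (cong (p i ∸_) t′i≡m) pi∸m≡pi) (reach-*∸≤Σp p↠t′ i))
      where
      open RawMonad ¬¬-Monad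
      TerminalValue : ℕ → Set
      TerminalValue m = ∃ λ t → Reach A p t × Terminal A t × t i ≡ m

    Drainable : ∀ {n} → ℕ → Position n → Set
    Drainable c q = a * c ≤ cappedΣ c q

    tall-move-drainable : ∀ {n c} {q : Position n} {S} → S ⊆ atLeast (suc c) q → ∣ S ∣ ≡ a →
                          Drainable c (apply q S)
    tall-move-drainable {c = c} {q} {S} S-tall ∣S∣≡a =
      subst (_≤ cappedΣ c (apply q S)) (trans (cong (c *_) ∣S∣≡a) (*-comm c a))
            (⊆atLeast⇒c*∣S∣≤cappedΣ S-tall)

    short-move-drainable : ∀ {n c} {q : Position n} {S} → atLeast (suc c) q ⊆ S → S ⊆ atLeast 1 q →
                           ∣ S ∣ ≡ a → Drainable (suc c) q → Drainable c (apply q S)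
    short-move-drainable {c = c} {q} {S} tall⊆S S-nonempty ∣S∣≡a drainable =
      +-cancelʳ-≤ a (a * c) (cappedΣ c (apply q S)) (begin
        a * c + a                      ≡⟨ +-comm (a * c) a ⟩
        a + a * c                      ≡⟨ sym (*-suc a c) ⟩
        a * suc c                      ≤⟨ drainable ⟩
        cappedΣ (suc c) q              ≡⟨ sym (atLeast⊆⇒cappedΣ-apply tall⊆S S-nonempty) ⟩
        cappedΣ c (apply q S) + ∣ S ∣  ≡⟨ cong (cappedΣ c (apply q S) +_) ∣S∣≡a ⟩
        cappedΣ c (apply q S) + a      ∎)
      where open ≤-Reasoning

    drain-step-tall : ∀ {n c} {q : Position n} {i} → i ∈ atLeast (suc c) q → a ≤ ∣ atLeast (suc c) q ∣ →
                      ∃ λ S → LegalMove A q a S × i ∈ S × Drainable c (apply q S)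
    drain-step-tall {c = c} {q} {i} i-tall a≤∣tall∣ =
      let S , ⁅i⁆⊆S , S-tall , ∣S∣≡a = ⊆-between a ⁅i⁆⊆tall ∣⁅i⁆∣≤a a≤∣tall∣
      in  S , (a∈A , ∣S∣≡a , λ j j∈S → ≤-trans (s≤s z≤n) (∈-atLeast⁻ q j (S-tall j∈S))) ,
          ⁅i⁆⊆S (x∈⁅x⁆ i) , tall-move-drainable S-tall ∣S∣≡a
      where
      ⁅i⁆⊆tall : ⁅ i ⁆ ⊆ atLeast (suc c) q
      ⁅i⁆⊆tall j∈⁅i⁆ = subst (_∈ atLeast (suc c) q) (sym (x∈⁅y⁆⇒x≡y i j∈⁅i⁆)) i-tall
      ∣⁅i⁆∣≤a : ∣ ⁅ i ⁆ ∣ ≤ a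
      ∣⁅i⁆∣≤a = subst (_≤ a) (sym (∣⁅x⁆∣≡1 i)) (A-positive a∈A)

    drain-step-short : ∀ {n c} {q : Position n} {i} → i ∈ atLeast (suc c) q → ∣ atLeast (suc c) q ∣ < a →
                       Drainable (suc c) q → ∃ λ S → LegalMove A q a S × i ∈ S × Drainable c (apply q S)
    drain-step-short {c = c} {q} {i} i-tall ∣tall∣<a drainable =
      let S , tall⊆S , S-nonempty , ∣S∣≡a = ⊆-between a tall⊆nonempty (<⇒≤ ∣tall∣<a) a≤∣nonempty∣
      in  S , (a∈A , ∣S∣≡a , λ j j∈S → ∈-atLeast⁻ q j (S-nonempty j∈S)) ,
          tall⊆S i-tall , short-move-drainable tall⊆S S-nonempty ∣S∣≡a drainable
      where
      open ≤-Reasoning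
      tall⊆nonempty : atLeast (suc c) q ⊆ atLeast 1 q
      tall⊆nonempty {j} j-tall = ∈-atLeast⁺ q j (≤-trans (s≤s z≤n) (∈-atLeast⁻ q j j-tall))
      a≤∣nonempty∣ : a ≤ ∣ atLeast 1 q ∣
      a≤∣nonempty∣ = *-cancelˡ-≤ (suc c) (begin
        suc c * a                ≡⟨ *-comm (suc c) a ⟩
        a * suc c                ≤⟨ drainable ⟩
        cappedΣ (suc c) q        ≤⟨ Σp≤c*∣S∣ (atLeast 1 q) (λ j → m⊓n≤n (q j) (suc c))
                                     (λ j j-empty → cong (_⊓ suc c) (n≤0⇒n≡0 (≮⇒≥ (j-empty ∘ ∈-atLeast⁺ q j)))) ⟩
        suc c * ∣ atLeast 1 q ∣  ∎)

    drain-step : ∀ {n c} {q : Position n} {i} → q i ≡ suc c → Drainable (suc c) q →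
                 ∃ λ S → LegalMove A q a S × i ∈ S × Drainable c (apply q S)
    drain-step {c = c} {q} {i} qi≡1+c drainable with a ≤? ∣ atLeast (suc c) q ∣
    ... | yes a≤∣tall∣ = drain-step-tall (∈-atLeast⁺ q i (≤-reflexive (sym qi≡1+c))) a≤∣tall∣
    ... | no  a≰∣tall∣ = drain-step-short (∈-atLeast⁺ q i (≤-reflexive (sym qi≡1+c))) (≰⇒> a≰∣tall∣) drainable

    drain : ∀ {n} (q : Position n) i c → q i ≡ c → Drainable c q → ∃ λ t → Reach A q t × t i ≡ 0
    drain q i zero    qi≡0   _         = q , ε , qi≡0
    drain q i (suc c) qi≡1+c drainable =
      let S , legal , i∈S , drainable′ = drain-step qi≡1+c drainable
          t , q′↠t , ti≡0 = drain (apply q S) i c (trans (apply-∈ q i∈S) (cong (_∸ 1) qi≡1+c)) drainable′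
      in  t , (a , S , legal , λ _ → refl) ◅ q′↠t , ti≡0

    bounded⇒drainable : ∀ {n M c} {q : Position n} → (∀ j → q j ≤ M) → a * M ≤ Σp q → c ≤ M → Drainable c q
    bounded⇒drainable {c = zero} {q} _ _ _ = subst (_≤ cappedΣ 0 q) (sym (*-zeroʳ a)) z≤n
    bounded⇒drainable {M = M} {c@(suc _)} {q} q≤M a*M≤Σq c≤M@(s≤s _) = *-cancelˡ-≤ M (begin
      M * (a * c)               ≡⟨ *-comm M (a * c) ⟩
      a * c * M                 ≡⟨ cong (_* M) (*-comm a c) ⟩
      c * a * M                 ≡⟨ *-assoc c a M ⟩
      c * (a * M)               ≤⟨ *-monoʳ-≤ c a*M≤Σq ⟩
      c * Σp q                  ≡⟨ *-distribˡ-sum c q ⟩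
      Σp (λ j → c * q j)        ≤⟨ Σp-mono (λ j → c*x≤M*[x⊓c] (q≤M j) c≤M) ⟩
      Σp (λ j → M * (q j ⊓ c))  ≡⟨ sym (*-distribˡ-sum M (λ j → q j ⊓ c)) ⟩
      M * cappedΣ c q           ∎)
      where open ≤-Reasoning

    bounded⇒reduced : ∀ {n} (q : Position n) M → (∀ j → q j ≤ M) → a * M ≤ Σp q → Reduced A q
    bounded⇒reduced q M q≤M a*M≤Σq i m (_ , m-least) = cong (q i ∸_) m≡0
      where
      open RawMonad ¬¬-Monad
      m≡0 : m ≡ 0
      m≡0 = decidable-stable (m ≟ 0) do
        let t , q↠t , ti≡0 = drain q i (q i) refl (bounded⇒drainable q≤M a*M≤Σq (q≤M i))
        t′ , t↠t′ , t′-terminal ← terminal-reachable t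
        pure (n≤0⇒n≡0 (≤-trans (m-least t′ (q↠t ◅◅ t↠t′) t′-terminal)
                               (≤-trans (reach-≤ t↠t′ i) (≤-reflexive ti≡0))))

    apply-unreduced⇒Σp< : ∀ {n} {p : Position n} {ℓ S} M → LegalMove A p ℓ S → (∀ j → apply p S j ≤ M) →
                          ¬ Reduced A (apply p S) → Σp p < a * M + ℓ
    apply-unreduced⇒Σp< {p = p} {ℓ} {S} M legal bounded unreduced = ≰⇒> λ a*M+ℓ≤Σp →
      unreduced (bounded⇒reduced (apply p S) M bounded
        (+-cancelʳ-≤ ℓ (a * M) (Σp (apply p S)) (subst (a * M + ℓ ≤_) (sym (Σp-legal legal)) a*M+ℓ≤Σp)))

    excess<ℓ : ∀ {n} {p : Position n} {m ℓ S} → (∀ j → p j ≤ p m) → Reduced A p → LegalMove A p ℓ S →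
               ¬ Reduced A (apply p S) → Σ ℕ λ r → Σp p ≡ a * p m + r × r < ℓ
    excess<ℓ {p = p} {m} {S = S} p≤pm reduced legal unreduced =
      excess (reduced⇒*≤Σp reduced m)
             (apply-unreduced⇒Σp< (p m) legal (λ j → ≤-trans (apply-≤ p S j) (p≤pm j)) unreduced)

    excess<ℓ∸a : ∀ {n} {p : Position n} {m ℓ S} → (∀ j → p j ≤ p m) → (∀ j → p j ≡ p m → j ∈ S) →
                 Reduced A p → LegalMove A p ℓ S → ¬ Reduced A (apply p S) →
                 a < ℓ × Σ ℕ λ r → Σp p ≡ a * p m + r × r < ℓ ∸ a
    excess<ℓ∸a {p = p} {m} {ℓ} {S} p≤pm max-played reduced legal unreduced =
      excess-shifted ℓ≤Σp (reduced⇒*≤Σp reduced m) (apply-unreduced⇒Σp< (p m ∸ 1) legal below-max unreduced)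
      where
      ℓ≤Σp : ℓ ≤ Σp p
      ℓ≤Σp = subst (ℓ ≤_) (Σp-legal legal) (m≤n+m ℓ _)
      below-max : ∀ j → apply p S j ≤ p m ∸ 1
      below-max j with j ∈? S
      ... | yes j∈S = subst (_≤ p m ∸ 1) (sym (apply-∈ p j∈S)) (∸-monoˡ-≤ 1 (p≤pm j))
      ... | no  j∉S = subst (_≤ p m ∸ 1) (sym (apply-∉ p j∉S))
                        (m+n≤o⇒m≤o∸n (p j) (subst (_≤ p m) (+-comm 1 (p j)) (≤∧≢⇒< (p≤pm j) (j∉S ∘ max-played j))))

lemma4 : (k : ℕ) (A : List ℕ) → All (λ x → 1 ≤ x × x ≤ suc k) A →
    (a : ℕ) → a ∈ₗ A → All (λ x → a ≤ x) A →
    (p : Position (suc k)) → (∀ i j → i ≤ᶠ j → p i ≤ p j) →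
    (∀ i → p i ≤ p (fromℕ k)) → Reduced A p →
    (ℓ : ℕ) (S : Subset (suc k)) → LegalMove A p ℓ S →
    ¬ Reduced A (apply p S) →
    (a < ℓ × (∀ i → p i ≡ p (fromℕ k) → i ∈ S) ×
       (Σ ℕ λ r → Σp p ≡ a * p (fromℕ k) + r × r < ℓ ∸ a))
    ⊎
    ((∃ λ i → p i ≡ p (fromℕ k) × i ∉ S) ×
       (Σ ℕ λ r → Σp p ≡ a * p (fromℕ k) + r × r < ℓ))
lemma4 k A A-bounds a a∈A a≤A p _ p≤P reduced ℓ S legal unreduced =
  case any? (λ i → (p i ≟ P) ×-dec ¬? (i ∈? S)) of λ where
    (yes unplayed-max) → inj₂ (unplayed-max , excess<ℓ p≤P reduced legal unreduced)
    (no ∄unplayed-max) →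
      let max-played : ∀ i → p i ≡ P → i ∈ S
          max-played i pi≡P = decidable-stable (i ∈? S) λ i∉S → ∄unplayed-max (i , pi≡P , i∉S)
          a<ℓ , excess<ℓ∸a′ = excess<ℓ∸a p≤P max-played reduced legal unreduced
      in  inj₁ (a<ℓ , max-played , excess<ℓ∸a′)
  where
  P = p (fromℕ k)
  open Moves (λ ℓ∈A → proj₁ (All.lookup A-bounds ℓ∈A))
  open Minimal a∈A (All.lookup a≤A)
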